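{- Let $G$ be a finite, simple, undirected, connected graph. If two vertices $u,v$ of $G$ are twins and have degree at least $1$, then both $u$ and $v$ belong to every MEG-set of $G$.
   Context: Distinct vertices $u,v$ are open twins if $N(u)=N(v)$ and closed twins if $N[u]=N[v]$, where $N(x)$ is the set of neighbors of $x$ and $N[x]=N(x)\cup\{x\}$; they are twins if they are open or closed twins. Two vertices $x,y$ monitor an edge $e$ if $e$ belongs to all shortest paths between $x$ and $y$; a set $S\subseteq V(G)$ is an MEG-set if for every edge $e$ of $G$ some pair $x,y\in S$ monitors $e$. -}

module Defs where

open import Data.Nat using (ℕ; zero; suc; _≤_)
open import Data.Fin using (Fin)
open import Data.Fin.Subset using (Subset; _∈_)
open import Data.Bool using (Bool; true; false; T)
open import Data.Product using (Σ; ∃; _×_; _,_)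
open import Data.Sum using (_⊎_)
open import Data.List using (List; []; _∷_)
open import Data.List.Membership.Propositional renaming (_∈_ to _∈ˡ_)
open import Relation.Binary.PropositionalEquality using (_≡_; _≢_)
open import Function.Bundles using (_⇔_)

record Graph (n : ℕ) : Set where
  field
    adj    : Fin n → Fin n → Bool
    sym    : ∀ u v → adj u v ≡ adj v u
    irrefl : ∀ u → adj u u ≡ false

module _ {n : ℕ} (G : Graph n) where
  open Graph G

  Adj : Fin n → Fin n → Set
  Adj u v = T (adj u v)

  data Walk : Fin n → Fin n → Set where
    [] : ∀ {x} → Walk x x
    step : ∀ {x} y {z} → Adj x y → Walk y z → Walk x z

  length : ∀ {x y} → Walk x y → ℕ
  length [] = zero
  length (step _ _ w) = suc (length w)

  edgesOf : ∀ {x y} → Walk x y → List (Fin n × Fin n)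
  edgesOf [] = []
  edgesOf {x} (step y _ w) = (x , y) ∷ edgesOf w

  EdgeOn : ∀ {x y} → Fin n → Fin n → Walk x y → Set
  EdgeOn a b w = ((a , b) ∈ˡ edgesOf w) ⊎ ((b , a) ∈ˡ edgesOf w)

  IsShortest : ∀ {x y} → Walk x y → Set
  IsShortest {x} {y} w = ∀ (w' : Walk x y) → length w ≤ length w'

  Connected : Set
  Connected = ∀ x y → Walk x y

  Monitors : Fin n → Fin n → Fin n → Fin n → Set
  Monitors x y a b = ∀ (w : Walk x y) → IsShortest w → EdgeOn a b w

  IsMEGSet : Subset n → Set
  IsMEGSet S = ∀ a b → Adj a b →
    Σ (Fin n) λ x → Σ (Fin n) λ y → x ∈ S × y ∈ S × Monitors x y a b

  OpenTwins : Fin n → Fin n → Set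
  OpenTwins u v = ∀ w → Adj u w ⇔ Adj v w

  ClosedTwins : Fin n → Fin n → Set
  ClosedTwins u v = ∀ w → ((w ≡ u) ⊎ Adj u w) ⇔ ((w ≡ v) ⊎ Adj v w)

  Twins : Fin n → Fin n → Set
  Twins u v = u ≢ v × (OpenTwins u v ⊎ ClosedTwins u v)

  HasNeighbour : Fin n → Set
  HasNeighbour u = ∃ λ w → Adj u w

{-# OPTIONS --safe #-}
-- If u and v are twins, every neighbour of u other than v is a neighbour of v.
-- Hence merging u into v maps every walk to a walk that avoids u and is no
-- longer, with the same endpoints as long as these differ from u.  So if
-- neither x nor y is u, the image of a shortest x-y path is again shortest and
-- misses every edge at u: no pair outside {u} monitors an edge at u.
module Submission where

open import Defs
open import Data.Nat using (ℕ; suc; _≤_; _<_; _≤?_; z≤n; s≤s)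
open import Data.Nat.Properties using (≤-refl; ≤-trans; <-≤-trans; ≰⇒>; m≤n⇒m≤1+n)
open import Data.Fin using (Fin; _≟_)
open import Data.Fin.Subset using (Subset; _∈_)
open import Data.Fin.Subset.Properties using (_∈?_)
open import Data.Product using (_×_; _,_; proj₁; proj₂)
open import Data.Sum using (_⊎_; inj₁; inj₂; map)
open import Data.Bool using (T)
open import Data.Empty using (⊥; ⊥-elim)
open import Data.List.Relation.Unary.All as All using (All; []; _∷_)
open import Relation.Nullary using (¬_; yes; no)
open import Relation.Binary.PropositionalEquality
  using (_≡_; _≢_; refl; sym; subst; subst₂; ≢-sym)
open import Function.Bundles using (Equivalence)
import Function.Properties.Equivalence as ⇔

module _ {n : ℕ} (G : Graph n) where

  Adj-sym : ∀ {a b} → Adj G a b → Adj G b a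
  Adj-sym {a} {b} = subst T (Graph.sym G a b)

  length-subst₂ : ∀ {a a′ b b′} (eqa : a ≡ a′) (eqb : b ≡ b′) (w : Walk G a b) →
    length G (subst₂ (Walk G) eqa eqb w) ≡ length G w
  length-subst₂ refl refl w = refl

  edgesOf-subst₂ : ∀ {a a′ b b′} (eqa : a ≡ a′) (eqb : b ≡ b′) (w : Walk G a b) →
    edgesOf G (subst₂ (Walk G) eqa eqb w) ≡ edgesOf G w
  edgesOf-subst₂ refl refl w = refl

  -- IsShortest quantifies over infinitely many walks, so only the double negation is available.
  shortest-¬¬ : ∀ {x y} → Walk G x y → ¬ (∀ (p : Walk G x y) → ¬ IsShortest G p)
  shortest-¬¬ {x} {y} w none = bounded (suc (length G w)) w ≤-refl
    where
    bounded : ∀ k (p : Walk G x y) → length G p < k → ⊥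
    bounded (suc k) p (s≤s p≤k) = none p shortest
      where
      shortest : IsShortest G p
      shortest p′ with length G p ≤? length G p′
      ... | yes p≤p′ = p≤p′
      ... | no p≰p′ = ⊥-elim (bounded k p′ (<-≤-trans (≰⇒> p≰p′) p≤k))

  module WeakHomomorphism (f : Fin n → Fin n)
    (f-adj : ∀ {x y} → Adj G x y → f x ≡ f y ⊎ Adj G (f x) (f y)) where

    mapWalk : ∀ {x y} → Walk G x y → Walk G (f x) (f y)
    mapWalk [] = []
    mapWalk (step y xy w) with f-adj xy
    ... | inj₁ fx≡fy = subst₂ (Walk G) (sym fx≡fy) refl (mapWalk w)
    ... | inj₂ fxfy = step (f y) fxfy (mapWalk w)

    length-mapWalk : ∀ {x y} (w : Walk G x y) → length G (mapWalk w) ≤ length G w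
    length-mapWalk [] = z≤n
    length-mapWalk (step y xy w) with f-adj xy
    ... | inj₁ fx≡fy rewrite length-subst₂ (sym fx≡fy) refl (mapWalk w) =
      m≤n⇒m≤1+n (length-mapWalk w)
    ... | inj₂ _ = s≤s (length-mapWalk w)

    edgesOf-mapWalk : ∀ {P : Fin n → Set} → (∀ z → P (f z)) → ∀ {x y} (w : Walk G x y) →
      All (λ e → P (proj₁ e) × P (proj₂ e)) (edgesOf G (mapWalk w))
    edgesOf-mapWalk P∘f [] = []
    edgesOf-mapWalk P∘f {x} (step y xy w) with f-adj xy
    ... | inj₁ fx≡fy =
      subst (All _) (sym (edgesOf-subst₂ (sym fx≡fy) refl (mapWalk w)))
            (edgesOf-mapWalk P∘f w)
    ... | inj₂ _ = (P∘f x , P∘f y) ∷ edgesOf-mapWalk P∘f w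

  NeighboursCovered : Fin n → Fin n → Set
  NeighboursCovered u v = ∀ z → Adj G u z → z ≢ v → Adj G v z

  module Merge {u v : Fin n} (u≢v : u ≢ v) (covered : NeighboursCovered u v) where

    merge : Fin n → Fin n
    merge z with z ≟ u
    ... | yes _ = v
    ... | no _ = z

    merge-≢ : ∀ z → merge z ≢ u
    merge-≢ z with z ≟ u
    ... | yes _ = ≢-sym u≢v
    ... | no z≢u = z≢u

    merge-fixes : ∀ {z} → z ≢ u → merge z ≡ z
    merge-fixes {z} z≢u with z ≟ u
    ... | yes z≡u = ⊥-elim (z≢u z≡u)
    ... | no _ = refl

    merge-adj : ∀ {x y} → Adj G x y → merge x ≡ merge y ⊎ Adj G (merge x) (merge y)
    merge-adj {x} {y} xy with x ≟ u | y ≟ u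
    ... | yes refl | yes refl = inj₁ refl
    ... | yes refl | no _ with y ≟ v
    ...   | yes refl = inj₁ refl
    ...   | no y≢v = inj₂ (covered y xy y≢v)
    merge-adj {x} {y} xy | no _ | yes refl with x ≟ v
    ...   | yes refl = inj₁ refl
    ...   | no x≢v = inj₂ (Adj-sym (covered x (Adj-sym xy) x≢v))
    merge-adj xy | no _ | no _ = inj₂ xy

    open WeakHomomorphism merge merge-adj

    ¬monitors : ∀ {x y w} → Walk G x y → x ≢ u → y ≢ u → ¬ Monitors G x y u w
    ¬monitors {x} {y} {w} xy x≢u y≢u monitors = shortest-¬¬ xy missesEdge
      where
      missesEdge : ∀ (p : Walk G x y) → ¬ IsShortest G p
      missesEdge p p-shortest = avoids-u (monitors q q-shortest)
        where
        fixes-x : merge x ≡ x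
        fixes-x = merge-fixes x≢u
        fixes-y : merge y ≡ y
        fixes-y = merge-fixes y≢u
        q : Walk G x y
        q = subst₂ (Walk G) fixes-x fixes-y (mapWalk p)
        q-shortest : IsShortest G q
        q-shortest p′ rewrite length-subst₂ fixes-x fixes-y (mapWalk p) =
          ≤-trans (length-mapWalk p) (p-shortest p′)
        edges-avoid-u : All (λ e → proj₁ e ≢ u × proj₂ e ≢ u) (edgesOf G q)
        edges-avoid-u rewrite edgesOf-subst₂ fixes-x fixes-y (mapWalk p) =
          edgesOf-mapWalk merge-≢ p
        avoids-u : ¬ EdgeOn G u w q
        avoids-u (inj₁ uw∈q) = proj₁ (All.lookup edges-avoid-u uw∈q) refl
        avoids-u (inj₂ wu∈q) = proj₂ (All.lookup edges-avoid-u wu∈q) refl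

  covered∈MEGSet : Connected G → ∀ {u v} → u ≢ v → NeighboursCovered u v →
    HasNeighbour G u → ∀ S → IsMEGSet G S → u ∈ S
  covered∈MEGSet connected {u} u≢v covered (w , uw) S isMEG with u ∈? S
  ... | yes u∈S = u∈S
  ... | no u∉S with isMEG u w uw
  ...   | x , y , x∈S , y∈S , monitors =
    ⊥-elim (Merge.¬monitors u≢v covered (connected x y) (∉S x∈S) (∉S y∈S) monitors)
    where
    ∉S : ∀ {z} → z ∈ S → z ≢ u
    ∉S z∈S refl = u∉S z∈S

  twins-sym : ∀ {u v} → Twins G u v → Twins G v u
  twins-sym (u≢v , twins) =
    ≢-sym u≢v , map (λ open-twins z → ⇔.sym (open-twins z))
                    (λ closed-twins z → ⇔.sym (closed-twins z)) twins

  twins⇒neighboursCovered : ∀ {u v} → Twins G u v → NeighboursCovered u v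
  twins⇒neighboursCovered (_ , inj₁ open-twins) z uz _ = Equivalence.to (open-twins z) uz
  twins⇒neighboursCovered (_ , inj₂ closed-twins) z uz z≢v
    with Equivalence.to (closed-twins z) (inj₂ uz)
  ... | inj₁ z≡v = ⊥-elim (z≢v z≡v)
  ... | inj₂ vz = vz

lemma2 : ∀ {n : ℕ} (G : Graph n) → Connected G →
    ∀ (u v : Fin n) → Twins G u v → HasNeighbour G u → HasNeighbour G v →
    ∀ (S : Subset n) → IsMEGSet G S → (u ∈ S) × (v ∈ S)
lemma2 G connected u v twins hasNeighbour-u hasNeighbour-v S isMEG =
  covered∈MEGSet G connected (proj₁ twins) (twins⇒neighboursCovered G twins)
    hasNeighbour-u S isMEG ,
  covered∈MEGSet G connected (proj₁ twins′) (twins⇒neighboursCovered G twins′)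
    hasNeighbour-v S isMEG
  where
  twins′ : Twins G v u
  twins′ = twins-sym G twins
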